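{- Let $a$ be a positive integer. The Simple Chopsticks position $[1^a]\,[1^a]_3$ (finger count $3$, each player having $a$ hands each with one raised finger) is an $\mathcal{N}$-position, i.e. the player who moves first has a winning strategy.
   Context: Simple Chopsticks. Fix a positive integer $n$, the finger count. A position $[x_1,\ldots,x_\ell]\,[y_1,\ldots,y_r]_n$ consists of a finite non-decreasing sequence of integers in $\{1,\ldots,n\}$ for Left (her hands) and one for Right; either list may be empty. Left's moves: for any $i,j$, replace $y_j$ by $y_j+x_i$, removing the entry from Right's list if $y_j+x_i>n$. Right's moves: for any $i,j$, replace $x_i$ by $x_i+y_j$, removing it if $x_i+y_j>n$. No moves exist when either list is empty. Normal play: a player unable to move loses. Notation: $k^a$ denotes $k$ repeated $a$ times. -}

module Defs where

open import Data.Nat using (ℕ; _+_; _≤ᵇ_)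
open import Data.Bool using (if_then_else_)
open import Data.List using (List; []; _∷_; _++_)
open import Data.List.Membership.Propositional using (_∈_)
open import Data.Product using (_×_; _,_; Σ)
open import Relation.Binary.PropositionalEquality using (_≡_)

-- A position seen from the player to move: (mover's hands , opponent's hands).
-- Hand lists are treated as multisets: order of entries is irrelevant to play.
Pos : Set
Pos = List ℕ × List ℕ

hit : ℕ → ℕ → ℕ → List ℕ
hit n x y = if (x + y) ≤ᵇ n then (x + y) ∷ [] else []

data Move (n : ℕ) : Pos → Pos → Set where
  move : ∀ {xs ys zs} (x y : ℕ) (ys₁ ys₂ : List ℕ) →
         x ∈ xs →
         ys ≡ ys₁ ++ y ∷ ys₂ →
         zs ≡ ys₁ ++ hit n x y ++ ys₂ →
         Move n (xs , ys) (zs , xs)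

-- Normal play outcome classes relative to the player to move (the game is
-- finite, so the inductive definitions capture winning strategies).
mutual
  data MoverWins (n : ℕ) (p : Pos) : Set where
    win : ∀ q → Move n p q → MoverLoses n q → MoverWins n p

  data MoverLoses (n : ℕ) (p : Pos) : Set where
    lose : (∀ q → Move n p q → MoverWins n q) → MoverLoses n p

-- [L] [R]_n is an N-position: whoever moves first wins.
-- If Left moves first, Left is the mover at (L , R);
-- if Right moves first, Right is the mover at (R , L).
IsNPosition : ℕ → List ℕ → List ℕ → Set
IsNPosition n L R = MoverWins n (L , R) × MoverWins n (R , L)

-- The first player taps a 1 onto a 1 and from then on always hits the opponent's
-- largest hand with her own largest one.  Whenever the opponent is to move, he holds
-- s hands showing 1 and at most one other hand, and the first player's hands satisfy
--   * against 1^s:   more than s hands, and more than s + 1 if she holds both a 2 and a 3;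
--   * against 1^s 2: all hands show 1, and there are more than s of them;
--   * against 1^s 3: no hand shows 3, and there are more than s + 1 of them.
-- Every reply of the opponent lets her restore one of these, so she always has a move,
-- and every exchange shrinks the opponent's hands, so he eventually runs out of moves.
-- The game is played on tallies (numbers of hands showing 1, 2 and 3), which
-- determine a position up to the order of the hands.

module Submission where

open import Defs

open import Algebra.Properties.CommutativeSemigroup as CommSemigroupProps using ()
open import Data.Bool using (if_then_else_)
open import Data.List using (List; []; _∷_; _++_; [_]; replicate)
open import Data.List.Membership.Propositional using (_∈_)
open import Data.List.Membership.Propositional.Properties using (∈-∃++)
open import Data.List.Relation.Unary.All as All using (All; []; _∷_)
open import Data.List.Relation.Unary.All.Properties using (++⁺; ++⁻; ++⁻ʳ; replicate⁺)
open import Data.List.Relation.Unary.Any using (here; there)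
open import Data.Nat using (ℕ; zero; suc; _+_; _≤_; _<_; _≡ᵇ_; s≤s)
open import Data.Nat.Properties using (+-assoc; +-identityʳ; +-suc; +-commutativeSemigroup; <⇒≤; <-pred; n<1+n)
open import Data.Product using (∃; ∃₂; _×_; _,_)
open import Data.Sum using (_⊎_; inj₁; inj₂)
open import Function using (_∘_)
open import Relation.Binary.PropositionalEquality using (_≡_; refl; sym; trans; cong; subst; module ≡-Reasoning)

data Finger : Set where
  one two three : Finger

⟦_⟧ : Finger → ℕ
⟦ one ⟧   = 1
⟦ two ⟧   = 2
⟦ three ⟧ = 3

Fingers : List ℕ → Set
Fingers = All (λ v → ∃ λ f → ⟦ f ⟧ ≡ v)

record Hands : Set where
  constructor ⟨_,_,_⟩
  field
    ones twos threes : ℕ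

noHands : Hands
noHands = ⟨ 0 , 0 , 0 ⟩

infixr 5 _⊕_

_⊕_ : Hands → Hands → Hands
⟨ a , b , c ⟩ ⊕ ⟨ a′ , b′ , c′ ⟩ = ⟨ a + a′ , b + b′ , c + c′ ⟩

size : Hands → ℕ
size ⟨ a , b , c ⟩ = a + b + c

⟨⟩-cong : ∀ {a a′ b b′ c c′} → a ≡ a′ → b ≡ b′ → c ≡ c′ → ⟨ a , b , c ⟩ ≡ ⟨ a′ , b′ , c′ ⟩
⟨⟩-cong refl refl refl = refl

⊕-assoc : ∀ h₁ h₂ h₃ → (h₁ ⊕ h₂) ⊕ h₃ ≡ h₁ ⊕ (h₂ ⊕ h₃)
⊕-assoc ⟨ a , b , c ⟩ ⟨ a′ , b′ , c′ ⟩ ⟨ a″ , b″ , c″ ⟩ =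
  ⟨⟩-cong (+-assoc a a′ a″) (+-assoc b b′ b″) (+-assoc c c′ c″)

⊕-identityʳ : ∀ h → h ⊕ noHands ≡ h
⊕-identityʳ ⟨ a , b , c ⟩ = ⟨⟩-cong (+-identityʳ a) (+-identityʳ b) (+-identityʳ c)

⊕-exchange : ∀ h₁ h₂ h₃ → h₁ ⊕ (h₂ ⊕ h₃) ≡ h₂ ⊕ (h₁ ⊕ h₃)
⊕-exchange ⟨ a , b , c ⟩ ⟨ a′ , b′ , c′ ⟩ ⟨ a″ , b″ , c″ ⟩ =
  ⟨⟩-cong (x∙yz≈y∙xz a a′ a″) (x∙yz≈y∙xz b b′ b″) (x∙yz≈y∙xz c c′ c″)
  where open CommSemigroupProps +-commutativeSemigroup using (x∙yz≈y∙xz)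

indicator : ℕ → ℕ → ℕ
indicator k v = if v ≡ᵇ k then 1 else 0

unit : ℕ → Hands
unit v = ⟨ indicator 1 v , indicator 2 v , indicator 3 v ⟩

tally : List ℕ → Hands
tally []       = noHands
tally (v ∷ vs) = unit v ⊕ tally vs

tally-++ : ∀ xs ys → tally (xs ++ ys) ≡ tally xs ⊕ tally ys
tally-++ []       ys = refl
tally-++ (x ∷ xs) ys =
  trans (cong (unit x ⊕_) (tally-++ xs ys)) (sym (⊕-assoc (unit x) (tally xs) (tally ys)))

tally-middle : ∀ xs ys zs → tally (xs ++ ys ++ zs) ≡ tally ys ⊕ tally (xs ++ zs)
tally-middle xs ys zs = begin
  tally (xs ++ ys ++ zs)            ≡⟨ tally-++ xs (ys ++ zs) ⟩
  tally xs ⊕ tally (ys ++ zs)       ≡⟨ cong (tally xs ⊕_) (tally-++ ys zs) ⟩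
  tally xs ⊕ tally ys ⊕ tally zs    ≡⟨ ⊕-exchange (tally xs) (tally ys) (tally zs) ⟩
  tally ys ⊕ tally xs ⊕ tally zs    ≡⟨ cong (tally ys ⊕_) (tally-++ xs zs) ⟨
  tally ys ⊕ tally (xs ++ zs)       ∎
  where open ≡-Reasoning

data Remove : Hands → Finger → Hands → Set where
  remove-one   : ∀ {a b c} → Remove ⟨ suc a , b , c ⟩ one ⟨ a , b , c ⟩
  remove-two   : ∀ {a b c} → Remove ⟨ a , suc b , c ⟩ two ⟨ a , b , c ⟩
  remove-three : ∀ {a b c} → Remove ⟨ a , b , suc c ⟩ three ⟨ a , b , c ⟩

_∋_ : Hands → Finger → Set
h ∋ f = ∃ (Remove h f)

remove-functional : ∀ {h f r r′} → Remove h f r → Remove h f r′ → r ≡ r′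
remove-functional remove-one   remove-one   = refl
remove-functional remove-two   remove-two   = refl
remove-functional remove-three remove-three = refl

remove-unit : ∀ f h → Remove (unit ⟦ f ⟧ ⊕ h) f h
remove-unit one   ⟨ a , b , c ⟩ = remove-one
remove-unit two   ⟨ a , b , c ⟩ = remove-two
remove-unit three ⟨ a , b , c ⟩ = remove-three

remove-unit⁻ : ∀ f {g h r} → Remove (unit ⟦ f ⟧ ⊕ h) g r → f ≡ g ⊎ h ∋ g
remove-unit⁻ one   {h = ⟨ a , b , c ⟩} remove-one   = inj₁ refl
remove-unit⁻ one   {h = ⟨ a , b , c ⟩} remove-two   = inj₂ (_ , remove-two)
remove-unit⁻ one   {h = ⟨ a , b , c ⟩} remove-three = inj₂ (_ , remove-three)
remove-unit⁻ two   {h = ⟨ a , b , c ⟩} remove-one   = inj₂ (_ , remove-one)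
remove-unit⁻ two   {h = ⟨ a , b , c ⟩} remove-two   = inj₁ refl
remove-unit⁻ two   {h = ⟨ a , b , c ⟩} remove-three = inj₂ (_ , remove-three)
remove-unit⁻ three {h = ⟨ a , b , c ⟩} remove-one   = inj₂ (_ , remove-one)
remove-unit⁻ three {h = ⟨ a , b , c ⟩} remove-two   = inj₂ (_ , remove-two)
remove-unit⁻ three {h = ⟨ a , b , c ⟩} remove-three = inj₁ refl

remove-middle : ∀ xs f zs → Remove (tally (xs ++ ⟦ f ⟧ ∷ zs)) f (tally (xs ++ zs))
remove-middle xs f zs = subst (λ h → Remove h f (tally (xs ++ zs))) (sym tally≡) (remove-unit f _)
  where
  tally≡ : tally (xs ++ [ ⟦ f ⟧ ] ++ zs) ≡ unit ⟦ f ⟧ ⊕ tally (xs ++ zs)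
  tally≡ = trans (tally-middle xs [ ⟦ f ⟧ ] zs) (cong (_⊕ tally (xs ++ zs)) (⊕-identityʳ (unit ⟦ f ⟧)))

∈⇒∋ : ∀ {f xs} → ⟦ f ⟧ ∈ xs → tally xs ∋ f
∈⇒∋ {f} f∈xs with ∈-∃++ f∈xs
... | xs₁ , xs₂ , refl = _ , remove-middle xs₁ f xs₂

∋⇒∈ : ∀ {f xs} → Fingers xs → tally xs ∋ f → ⟦ f ⟧ ∈ xs
∋⇒∈ []               (_ , ())
∋⇒∈ ((g , refl) ∷ fs) (_ , rm) with remove-unit⁻ g rm
... | inj₁ refl = here refl
... | inj₂ f∈   = there (∋⇒∈ fs f∈)

remove⇒split : ∀ {f ys r} → Fingers ys → Remove (tally ys) f r →
               ∃₂ λ ys₁ ys₂ → ys ≡ ys₁ ++ ⟦ f ⟧ ∷ ys₂ × tally (ys₁ ++ ys₂) ≡ r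
remove⇒split {f} fs rm with ∈-∃++ (∋⇒∈ fs (_ , rm))
... | ys₁ , ys₂ , refl = ys₁ , ys₂ , refl , remove-functional (remove-middle ys₁ f ys₂) rm

hit-fingers : ∀ x y → Fingers (hit 3 ⟦ x ⟧ ⟦ y ⟧)
hit-fingers one   one   = (two , refl) ∷ []
hit-fingers one   two   = (three , refl) ∷ []
hit-fingers one   three = []
hit-fingers two   one   = (three , refl) ∷ []
hit-fingers two   two   = []
hit-fingers two   three = []
hit-fingers three one   = []
hit-fingers three two   = []
hit-fingers three three = []

fingers-hit : ∀ ys₁ {ys₂} x y → Fingers (ys₁ ++ ⟦ y ⟧ ∷ ys₂) → Fingers (ys₁ ++ hit 3 ⟦ x ⟧ ⟦ y ⟧ ++ ys₂)
fingers-hit ys₁ x y fs with ++⁻ ys₁ fs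
... | fs₁ , _ ∷ fs₂ = ++⁺ fs₁ (++⁺ (hit-fingers x y) fs₂)

data Tap (x : Finger) (h : Hands) : Hands → Set where
  tap : ∀ {y r} → Remove h y r → Tap x h (tally (hit 3 ⟦ x ⟧ ⟦ y ⟧) ⊕ r)

-- The player to move holds m, the other player o.
mutual
  data Wins (m o : Hands) : Set where
    win : ∀ {x o′} → m ∋ x → Tap x o o′ → Loses o′ m → Wins m o

  data Loses (m o : Hands) : Set where
    lose : (∀ {x o′} → m ∋ x → Tap x o o′ → Wins o′ m) → Loses m o

tally-move : ∀ {xs ys q} → Fingers xs → Fingers ys → Move 3 (xs , ys) q →
             ∃ λ zs → q ≡ (zs , xs) × Fingers zs × ∃ λ x → tally xs ∋ x × Tap x (tally ys) (tally zs)
tally-move fxs fys (move _ _ ys₁ ys₂ x∈xs refl refl) with All.lookup fxs x∈xs | All.head (++⁻ʳ ys₁ fys)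
... | x , refl | y , refl =
  _ , refl , fingers-hit ys₁ x y fys , x , ∈⇒∋ x∈xs ,
  subst (Tap x _) (sym (tally-middle ys₁ _ ys₂)) (tap (remove-middle ys₁ y ys₂))

mutual
  loses⇒moverLoses : ∀ {m o xs ys} → Loses m o → Fingers xs → Fingers ys →
                     tally xs ≡ m → tally ys ≡ o → MoverLoses 3 (xs , ys)
  loses⇒moverLoses (lose k) fxs fys refl refl = lose (λ _ mv → reply⇒moverWins k fxs fys mv)

  reply⇒moverWins : ∀ {xs ys q} → (∀ {x o′} → tally xs ∋ x → Tap x (tally ys) o′ → Wins o′ (tally xs)) →
                    Fingers xs → Fingers ys → Move 3 (xs , ys) q → MoverWins 3 q
  reply⇒moverWins k fxs fys mv with tally-move fxs fys mv
  ... | _ , refl , fzs , _ , x∈ , t = wins⇒moverWins (k x∈ t) fzs fxs refl refl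

  wins⇒moverWins : ∀ {m o xs ys} → Wins m o → Fingers xs → Fingers ys →
                   tally xs ≡ m → tally ys ≡ o → MoverWins 3 (xs , ys)
  wins⇒moverWins (win {x} x∈ (tap {y} rm) l) fxs fys refl refl with remove⇒split fys rm
  ... | ys₁ , ys₂ , refl , refl =
    win _ (move ⟦ x ⟧ ⟦ y ⟧ ys₁ ys₂ (∋⇒∈ fxs x∈) refl refl)
          (loses⇒moverLoses l (fingers-hit ys₁ x y fys) fxs (tally-middle ys₁ _ ys₂) refl)

data Both : Hands → Set where
  both : ∀ {a b c} → Both ⟨ a , suc b , suc c ⟩

size-twos : ∀ a b c → size ⟨ a , suc b , c ⟩ ≡ suc (size ⟨ a , b , c ⟩)
size-twos a b c = cong (_+ c) (+-suc a b)

size-threes : ∀ a b c → size ⟨ a , b , suc c ⟩ ≡ suc (size ⟨ a , b , c ⟩)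
size-threes a b c = +-suc (a + b) c

size-one→two : ∀ a b c → size ⟨ suc a , b , c ⟩ ≡ size ⟨ a , suc b , c ⟩
size-one→two a b c = sym (size-twos a b c)

size-two→three : ∀ a b c → size ⟨ a , suc b , c ⟩ ≡ size ⟨ a , b , suc c ⟩
size-two→three a b c = trans (size-twos a b c) (sym (size-threes a b c))

<-size-threes⁻ : ∀ {k} a b c → suc k < size ⟨ a , b , suc c ⟩ → k < size ⟨ a , b , c ⟩
<-size-threes⁻ {k} a b c = <-pred ∘ subst (suc k <_) (size-threes a b c)

<-size-twos⁻ : ∀ {k} a b c → suc k < size ⟨ a , suc b , c ⟩ → k < size ⟨ a , b , c ⟩
<-size-twos⁻ {k} a b c = <-pred ∘ subst (suc k <_) (size-twos a b c)

mutual
  ones-lose : ∀ s m → s < size m → (Both m → suc s < size m) → Loses ⟨ s , 0 , 0 ⟩ m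
  ones-lose s m s<m both⇒ = lose (ones-answer s m s<m both⇒)

  ones-answer : ∀ s m {x m′} → s < size m → (Both m → suc s < size m) →
                ⟨ s , 0 , 0 ⟩ ∋ x → Tap x m m′ → Wins m′ ⟨ s , 0 , 0 ⟩
  ones-answer (suc s) ⟨ suc a , b , zero ⟩ s<m _ (_ , remove-one) (tap remove-one) =
    win (_ , remove-two) (tap remove-one)
        (three-lose s a (suc b) (subst (suc s <_) (size-one→two a b 0) s<m))
  ones-answer (suc s) ⟨ suc a , b , suc c ⟩ s<m _ (_ , remove-one) (tap remove-one) =
    win (_ , remove-three) (tap remove-one) (ones-lose s m′ (<⇒≤ s<m′) (λ _ → s<m′))
    where
    m′ = ⟨ a , suc b , suc c ⟩
    s<m′ = subst (suc s <_) (size-one→two a b (suc c)) s<m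
  ones-answer (suc s) ⟨ a , suc b , c ⟩ s<m _ (_ , remove-one) (tap remove-two) =
    win (_ , remove-three) (tap remove-one) (ones-lose s m′ (<⇒≤ s<m′) (λ _ → s<m′))
    where
    m′ = ⟨ a , b , suc c ⟩
    s<m′ = subst (suc s <_) (size-two→three a b c) s<m
  ones-answer (suc s) ⟨ a , b , suc (suc c) ⟩ s<m both⇒ (_ , remove-one) (tap remove-three) =
    win (_ , remove-three) (tap remove-one)
        (ones-lose s ⟨ a , b , suc c ⟩ (<-size-threes⁻ a b (suc c) s<m)
                   (λ { both → <-size-threes⁻ a b (suc c) (both⇒ both) }))
  ones-answer (suc s) ⟨ a , suc b , suc zero ⟩ s<m both⇒ (_ , remove-one) (tap remove-three) =
    win (_ , remove-two) (tap remove-one) (three-lose s a (suc b) (<-size-threes⁻ a (suc b) 0 (both⇒ both)))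
  ones-answer (suc s) ⟨ suc a , zero , suc zero ⟩ s<m _ (_ , remove-one) (tap remove-three) =
    win (_ , remove-one) (tap remove-one) (two-lose s (suc a) (<-size-threes⁻ (suc a) 0 0 s<m))
  ones-answer (suc s) ⟨ zero , zero , suc zero ⟩ (s≤s ()) _ (_ , remove-one) (tap remove-three)

  two-lose : ∀ s n → s < size ⟨ n , 0 , 0 ⟩ → Loses ⟨ s , 1 , 0 ⟩ ⟨ n , 0 , 0 ⟩
  two-lose s n s<n = lose (two-answer s n s<n)

  two-answer : ∀ s n {x m′} → s < size ⟨ n , 0 , 0 ⟩ →
               ⟨ s , 1 , 0 ⟩ ∋ x → Tap x ⟨ n , 0 , 0 ⟩ m′ → Wins m′ ⟨ s , 1 , 0 ⟩
  two-answer (suc s) (suc n) s<n (_ , remove-one) (tap remove-one) =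
    win (_ , remove-two) (tap remove-two)
        (ones-lose (suc s) ⟨ n , 1 , 0 ⟩ (subst (suc s <_) (size-one→two n 0 0) s<n) λ ())
  two-answer s (suc n) s<n (_ , remove-two) (tap remove-one) =
    win (_ , remove-three) (tap remove-two)
        (ones-lose s ⟨ n , 0 , 1 ⟩ (subst (s <_) (sym (size-threes n 0 0)) s<n) λ ())

  kill-three : ∀ s m → s < size m → (Both m → suc s < size m) → Wins m ⟨ s , 0 , 1 ⟩
  kill-three s ⟨ suc a , b , c ⟩       s<m both⇒ = win (_ , remove-one) (tap remove-three) (ones-lose s _ s<m both⇒)
  kill-three s ⟨ zero , suc b , c ⟩    s<m both⇒ = win (_ , remove-two) (tap remove-three) (ones-lose s _ s<m both⇒)
  kill-three s ⟨ zero , zero , suc c ⟩ s<m both⇒ = win (_ , remove-three) (tap remove-three) (ones-lose s _ s<m both⇒)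

  three-lose : ∀ s a b → suc s < size ⟨ a , b , 0 ⟩ → Loses ⟨ s , 0 , 1 ⟩ ⟨ a , b , 0 ⟩
  three-lose s a b s<m = lose (three-answer s a b s<m)

  three-answer : ∀ s a b {x m′} → suc s < size ⟨ a , b , 0 ⟩ →
                 ⟨ s , 0 , 1 ⟩ ∋ x → Tap x ⟨ a , b , 0 ⟩ m′ → Wins m′ ⟨ s , 0 , 1 ⟩
  three-answer (suc s) (suc a) b s<m (_ , remove-one) (tap remove-one) =
    kill-three (suc s) ⟨ a , suc b , 0 ⟩ (subst (suc s <_) (size-one→two a b 0) (<⇒≤ s<m)) λ ()
  three-answer (suc s) a (suc b) s<m (_ , remove-one) (tap remove-two) =
    kill-three (suc s) ⟨ a , b , 1 ⟩ (<⇒≤ s<m′) (λ _ → s<m′)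
    where s<m′ = subst (suc (suc s) <_) (size-two→three a b 0) s<m
  three-answer s (suc a) b s<m (_ , remove-three) (tap remove-one) =
    kill-three s ⟨ a , b , 0 ⟩ (<-pred s<m) λ ()
  three-answer s a (suc b) s<m (_ , remove-three) (tap remove-two) =
    kill-three s ⟨ a , b , 0 ⟩ (<-size-twos⁻ a b 0 s<m) λ ()

tally-replicate : ∀ n → tally (replicate n 1) ≡ ⟨ n , 0 , 0 ⟩
tally-replicate zero    = refl
tally-replicate (suc n) = cong (unit 1 ⊕_) (tally-replicate n)

size-ones : ∀ n → size ⟨ n , 0 , 0 ⟩ ≡ n
size-ones n = trans (+-identityʳ (n + 0)) (+-identityʳ n)

ones-win : ∀ n → 1 ≤ n → Wins ⟨ n , 0 , 0 ⟩ ⟨ n , 0 , 0 ⟩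
ones-win (suc n) _ =
  win (_ , remove-one) (tap remove-one) (two-lose n (suc n) (subst (n <_) (sym (size-ones (suc n))) (n<1+n n)))

proposition3p6 : (a : ℕ) → 1 ≤ a → IsNPosition 3 (replicate a 1) (replicate a 1)
proposition3p6 a 1≤a = first , first
  where
  fingers : Fingers (replicate a 1)
  fingers = replicate⁺ a (one , refl)

  first : MoverWins 3 (replicate a 1 , replicate a 1)
  first = wins⇒moverWins (ones-win a 1≤a) fingers fingers (tally-replicate a) (tally-replicate a)
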